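{- Let $P=([n],\preceq)$ be a poset, $0\le r,m\le n$. If a $P$-code $\mathcal{C}\subseteq F^n$ with $|\mathcal{C}|=2^{n-m}$ is $r$-error-correcting, then $r\le m$.
   Context: $[n]=\{1,\dots,n\}$; subsets of $[n]$ are identified with their characteristic vectors in $F^n=\{0,1\}^n$, and $x+y$ is the symmetric difference. An ideal of $P$ is a set closed under going down; ${<}X{>}$ is the smallest ideal containing $X$. The $P$-weight is $w_P(x)=|{<}x{>}|$ and $\mathcal{B}_P^r=\{x\in F^n: w_P(x)\le r\}$. A $P$-code $\mathcal{C}\subseteq F^n$ is $r$-error-correcting if every $x\in F^n$ has at most one representation $x=c+b$ with $c\in\mathcal{C}$, $b\in\mathcal{B}_P^r$. -}

module Defs where

open import Data.Nat using (ℕ)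
open import Data.Bool using (_xor_)
open import Data.Fin using (Fin)
open import Data.Fin.Subset using (Subset; ∣_∣)
open import Data.Fin.Subset.Properties using (_∈?_)
open import Data.Fin.Properties using (any?)
open import Data.Vec using (zipWith; tabulate)
open import Relation.Nullary using (does)
open import Relation.Nullary.Decidable using (_×-dec_)
open import Relation.Binary using (Rel; Decidable)
open import Level using (0ℓ)

-- F^n = {0,1}^n, identified with subsets of [n] = Fin n.
-- Addition x + y is the symmetric difference (pointwise xor).
_⊕_ : ∀ {n} → Subset n → Subset n → Subset n
_⊕_ = zipWith _xor_

module _ {n : ℕ} (_≼_ : Rel (Fin n) 0ℓ) (_≼?_ : Decidable _≼_) where

  ideal : Subset n → Subset n
  ideal x = tabulate (λ i → does (any? (λ j → (j ∈? x) ×-dec (i ≼? j))))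

  wP : Subset n → ℕ
  wP x = ∣ ideal x ∣

module Submission where

-- Take an ideal I of P with |I| = m + 1 ≤ r (ideals of every size exist: grow one by a minimal
-- element of its complement). Two codewords c, c′ agreeing outside I differ by a vector
-- supported in I, whose P-weight is at most |I| ≤ r, so c + (c + c′) = c′ + 0 are two
-- decompositions and c = c′. Hence a codeword is determined by its restriction to the
-- complement of I, and 2^(n-m) = |C| ≤ 2^(n-m-1).

open import Defs
open import Data.Nat using (ℕ; _+_; _≤_; _∸_; _^_; zero; suc; _<_; z≤n; s≤s; s<s)
open import Data.Nat.Properties
  using (≤-trans; <⇒≤; ≮⇒≥; <⇒≱; ∸-monoʳ-<; ^-monoʳ-<; n<1+n; +-identityʳ)
open import Data.Bool using (true)
import Data.Bool as Bool
open import Data.Bool.Properties using (xor-same; xor-assoc; xor-identityˡ; xor-identityʳ)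
open import Data.Fin using (Fin; zero; suc)
import Data.Fin.Properties as Fin
open import Data.Fin.Subset
  using (Subset; inside; outside; ⊥; ⁅_⁆; ∁; _∪_; _─_; ∣_∣; _⊆_)
  renaming (_∈_ to _∈ₛ_; _∉_ to _∉ₛ_)
open import Data.Fin.Subset.Properties
  using (_∈?_; drop-there; drop-∷-⊆; ∉⊥; ∣⊥∣≡0; ∪-identityʳ; x∈p∪q⁻; x∈p∪q⁺; x∈⁅x⁆; x∈⁅y⁆⇒x≡y;
         x∉p⇒x∈∁p; ∣∁p∣≡n∸∣p∣; p⊆q⇒∣p∣≤∣q∣)
open import Data.Vec using ([]; _∷_; here; there; tail)
open import Data.Vec.Properties
  using (≡-dec; lookup∘tabulate; []=⇒lookup; zipWith-assoc; zipWith-identityˡ; zipWith-identityʳ)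
open import Data.List using (List; []; _∷_; [_]; length; map; _++_)
open import Data.List.Properties using (length-map; length-++; length-removeAt′)
open import Data.List.Membership.Propositional using (_∈_; find; lose)
open import Data.List.Membership.Propositional.Properties using (∈-map⁺; ∈-++⁺ˡ; ∈-++⁺ʳ)
open import Data.List.Relation.Unary.Any as Any using (index)
import Data.List.Relation.Unary.All as All
open import Data.List.Relation.Unary.AllPairs using (_∷_)
open import Data.List.Relation.Unary.Unique.Propositional using (Unique)
open import Data.Product using (_×_; _,_; proj₁; ∃; ∃₂)
open import Data.Sum using (inj₁; inj₂)
open import Function using (_∘_)
open import Induction.WellFounded using (Acc; acc)
open import Data.Fin.Induction using (po-wellFounded)
open import Relation.Nullary using (¬_; Dec; yes; no; does; proof; contradiction)
open import Relation.Nullary.Reflects using (Reflects; invert)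
open import Relation.Nullary.Decidable using (decidable-stable; ¬?; _×-dec_)
import Relation.Unary as U
open import Relation.Binary using (Rel; Decidable; DecidableEquality; IsPartialOrder)
import Relation.Binary.Construct.NonStrictToStrict as ToStrict
open import Relation.Binary.PropositionalEquality
  using (_≡_; _≢_; refl; sym; trans; cong; cong₂; subst; subst₂; module ≡-Reasoning)
open import Level using (0ℓ)

p⊕p≡⊥ : ∀ {n} (p : Subset n) → p ⊕ p ≡ ⊥
p⊕p≡⊥ []      = refl
p⊕p≡⊥ (x ∷ p) = cong₂ _∷_ (xor-same x) (p⊕p≡⊥ p)

p⊕[p⊕q]≡q⊕⊥ : ∀ {n} (p q : Subset n) → p ⊕ (p ⊕ q) ≡ q ⊕ ⊥
p⊕[p⊕q]≡q⊕⊥ p q = begin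
  p ⊕ (p ⊕ q) ≡⟨ zipWith-assoc xor-assoc p p q ⟨
  (p ⊕ p) ⊕ q ≡⟨ cong (_⊕ q) (p⊕p≡⊥ p) ⟩
  ⊥ ⊕ q       ≡⟨ zipWith-identityˡ xor-identityˡ q ⟩
  q           ≡⟨ zipWith-identityʳ xor-identityʳ q ⟨
  q ⊕ ⊥       ∎
  where open ≡-Reasoning

x∈p─q⇒x∉q : ∀ {n} {p q : Subset n} {x} → x ∈ₛ p ─ q → x ∉ₛ q
x∈p─q⇒x∉q {p = _ ∷ _} {outside ∷ _} here       ()
x∈p─q⇒x∉q {p = _ ∷ _} {_ ∷ _}       (there x∈) (there x∈q) = x∈p─q⇒x∉q x∈ x∈q

p─q⊆∁q : ∀ {n} (p q : Subset n) → p ─ q ⊆ ∁ q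
p─q⊆∁q p q = x∉p⇒x∈∁p ∘ x∈p─q⇒x∉q

p─r≡q─r⇒p⊕q⊆r : ∀ {n} (p q r : Subset n) → p ─ r ≡ q ─ r → p ⊕ q ⊆ r
p─r≡q─r⇒p⊕q⊆r (_ ∷ _)       (_ ∷ _)       (inside ∷ _)  _  {zero} _ = here
p─r≡q─r⇒p⊕q⊆r (inside ∷ _)  (outside ∷ _) (outside ∷ _) () {zero} _
p─r≡q─r⇒p⊕q⊆r (outside ∷ _) (inside ∷ _)  (outside ∷ _) () {zero} _
p─r≡q─r⇒p⊕q⊆r (inside ∷ _)  (inside ∷ _)  (outside ∷ _) _  {zero} ()
p─r≡q─r⇒p⊕q⊆r (outside ∷ _) (outside ∷ _) (outside ∷ _) _  {zero} ()
p─r≡q─r⇒p⊕q⊆r (_ ∷ p)       (_ ∷ q)       (_ ∷ r)       eq {suc _} x∈ =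
  there (p─r≡q─r⇒p⊕q⊆r p q r (cong tail eq) (drop-there x∈))

x∉p⇒∣p∪⁅x⁆∣≡1+∣p∣ : ∀ {n} {p : Subset n} {x} → x ∉ₛ p → ∣ p ∪ ⁅ x ⁆ ∣ ≡ suc ∣ p ∣
x∉p⇒∣p∪⁅x⁆∣≡1+∣p∣ {p = outside ∷ p} {zero}  _  = cong (suc ∘ ∣_∣) (∪-identityʳ p)
x∉p⇒∣p∪⁅x⁆∣≡1+∣p∣ {p = inside ∷ _}  {zero}  x∉ = contradiction here x∉
x∉p⇒∣p∪⁅x⁆∣≡1+∣p∣ {p = outside ∷ _} {suc _} x∉ = x∉p⇒∣p∪⁅x⁆∣≡1+∣p∣ (x∉ ∘ there)
x∉p⇒∣p∪⁅x⁆∣≡1+∣p∣ {p = inside ∷ _}  {suc _} x∉ = cong suc (x∉p⇒∣p∪⁅x⁆∣≡1+∣p∣ (x∉ ∘ there))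

∣p∣<n⇒∃∉ : ∀ {n} {p : Subset n} → ∣ p ∣ < n → ∃ λ x → x ∉ₛ p
∣p∣<n⇒∃∉ {p = outside ∷ _} _             = zero , λ ()
∣p∣<n⇒∃∉ {p = inside ∷ _}  (s<s ∣p∣<n) = let x , x∉p = ∣p∣<n⇒∃∉ ∣p∣<n in suc x , x∉p ∘ drop-there

subsets : ∀ {n} → Subset n → List (Subset n)
subsets []            = [ [] ]
subsets (outside ∷ p) = map (outside ∷_) (subsets p)
subsets (inside ∷ p)  = map (outside ∷_) (subsets p) ++ map (inside ∷_) (subsets p)

length-subsets : ∀ {n} (p : Subset n) → length (subsets p) ≡ 2 ^ ∣ p ∣
length-subsets []            = refl
length-subsets (outside ∷ p) = trans (length-map (outside ∷_) (subsets p)) (length-subsets p)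
length-subsets (inside ∷ p)  = begin
  length (map (outside ∷_) (subsets p) ++ map (inside ∷_) (subsets p))
    ≡⟨ length-++ (map (outside ∷_) (subsets p)) ⟩
  length (map (outside ∷_) (subsets p)) + length (map (inside ∷_) (subsets p))
    ≡⟨ cong₂ _+_ (length-map (outside ∷_) (subsets p)) (length-map (inside ∷_) (subsets p)) ⟩
  length (subsets p) + length (subsets p)
    ≡⟨ cong (λ k → k + k) (length-subsets p) ⟩
  2 ^ ∣ p ∣ + 2 ^ ∣ p ∣
    ≡⟨ cong (2 ^ ∣ p ∣ +_) (+-identityʳ (2 ^ ∣ p ∣)) ⟨
  2 ^ suc ∣ p ∣ ∎
  where open ≡-Reasoning

⊆⇒∈subsets : ∀ {n} {p q : Subset n} → q ⊆ p → q ∈ subsets p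
⊆⇒∈subsets {p = []}          {[]}          _   = Any.here refl
⊆⇒∈subsets {p = outside ∷ _} {outside ∷ _} q⊆p = ∈-map⁺ (outside ∷_) (⊆⇒∈subsets (drop-∷-⊆ q⊆p))
⊆⇒∈subsets {p = outside ∷ _} {inside ∷ _}  q⊆p = contradiction (q⊆p here) λ ()
⊆⇒∈subsets {p = inside ∷ _}  {outside ∷ _} q⊆p =
  ∈-++⁺ˡ (∈-map⁺ (outside ∷_) (⊆⇒∈subsets (drop-∷-⊆ q⊆p)))
⊆⇒∈subsets {p = inside ∷ p}  {inside ∷ _}  q⊆p =
  ∈-++⁺ʳ (map (outside ∷_) (subsets p)) (∈-map⁺ (inside ∷_) (⊆⇒∈subsets (drop-∷-⊆ q⊆p)))

module _ {A : Set} where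

  ∈-─⁺ : ∀ {x y} {ys : List A} (x∈ys : x ∈ ys) → y ∈ ys → y ≢ x → y ∈ (ys Any.─ x∈ys)
  ∈-─⁺ (Any.here x≡z)  (Any.here y≡z)  y≢x = contradiction (trans y≡z (sym x≡z)) y≢x
  ∈-─⁺ (Any.here _)    (Any.there y∈)  _   = y∈
  ∈-─⁺ (Any.there _)   (Any.here y≡z)  _   = Any.here y≡z
  ∈-─⁺ (Any.there x∈)  (Any.there y∈)  y≢x = Any.there (∈-─⁺ x∈ y∈ y≢x)

module _ {A B : Set} (_≟_ : DecidableEquality B) (f : A → B) where

  pigeonhole : ∀ {xs ys} → Unique xs → (∀ {x} → x ∈ xs → f x ∈ ys) → length ys < length xs →
               ∃₂ λ x y → x ∈ xs × y ∈ xs × x ≢ y × f x ≡ f y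
  pigeonhole {x ∷ xs} {ys} (x∉xs ∷ !xs) f[xs]⊆ys ∣ys∣<∣x∷xs∣ with Any.any? (λ y → f x ≟ f y) xs
  ... | yes fx∈f[xs] =
    let y , y∈xs , fx≡fy = find fx∈f[xs]
    in x , y , Any.here refl , Any.there y∈xs , All.lookup x∉xs y∈xs , fx≡fy
  ... | no fx∉f[xs] =
    let x′ , y′ , x′∈xs , y′∈xs , x′≢y′ , fx′≡fy′ = pigeonhole !xs f[xs]⊆ys─fx ∣ys─fx∣<∣xs∣
    in x′ , y′ , Any.there x′∈xs , Any.there y′∈xs , x′≢y′ , fx′≡fy′
    where
    fx∈ys : f x ∈ ys
    fx∈ys = f[xs]⊆ys (Any.here refl)

    f[xs]⊆ys─fx : ∀ {y} → y ∈ xs → f y ∈ (ys Any.─ fx∈ys)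
    f[xs]⊆ys─fx y∈xs = ∈-─⁺ fx∈ys (f[xs]⊆ys (Any.there y∈xs)) (fx∉f[xs] ∘ lose y∈xs ∘ sym)

    ∣ys─fx∣<∣xs∣ : length (ys Any.─ fx∈ys) < length xs
    ∣ys─fx∣<∣xs∣
      with s<s lt ← subst (_< suc (length xs)) (length-removeAt′ ys (index fx∈ys)) ∣ys∣<∣x∷xs∣
      = lt

module PosetCodes {n} {_≼_ : Rel (Fin n) 0ℓ} (po : IsPartialOrder _≡_ _≼_) (_≼?_ : Decidable _≼_) where

  open ToStrict _≡_ _≼_ using () renaming (_<_ to _≺_; <-decidable to ≺-decidable)

  IsIdeal : Subset n → Set
  IsIdeal I = ∀ {i j} → j ∈ₛ I → i ≼ j → i ∈ₛ I

  ErrorCorrecting : ℕ → List (Subset n) → Set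
  ErrorCorrecting r C = ∀ c c′ b b′ → c ∈ C → c′ ∈ C →
    wP _≼_ _≼?_ b ≤ r → wP _≼_ _≼?_ b′ ≤ r → c ⊕ b ≡ c′ ⊕ b′ → (c , b) ≡ (c′ , b′)

  ∈-ideal⁻ : ∀ {b i} → i ∈ₛ ideal _≼_ _≼?_ b → ∃ λ j → j ∈ₛ b × i ≼ j
  ∈-ideal⁻ {b} {i} i∈ = invert (subst (Reflects _) does≡true (proof ∃j?))
    where
    ∃j? : Dec (∃ λ j → j ∈ₛ b × i ≼ j)
    ∃j? = Fin.any? λ j → j ∈? b ×-dec i ≼? j

    does≡true : does ∃j? ≡ true
    does≡true = trans (sym (lookup∘tabulate _ i)) ([]=⇒lookup i∈)

  wP≤∣I∣ : ∀ {I b} → IsIdeal I → b ⊆ I → wP _≼_ _≼?_ b ≤ ∣ I ∣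
  wP≤∣I∣ isIdeal b⊆I = p⊆q⇒∣p∣≤∣q∣ λ i∈ → let j , j∈b , i≼j = ∈-ideal⁻ i∈ in isIdeal (b⊆I j∈b) i≼j

  ∃-minimal : ∀ {P : U.Pred (Fin n) 0ℓ} → U.Decidable P → ∀ {x} → P x →
            ∃ λ y → P y × ∀ {z} → P z → ¬ z ≺ y
  ∃-minimal {P} P? = go (po-wellFounded po _)
    where
    go : ∀ {x} → Acc _≺_ x → P x → ∃ λ y → P y × ∀ {z} → P z → ¬ z ≺ y
    go {x} (acc rs) Px with Fin.any? (λ z → P? z ×-dec ≺-decidable Fin._≟_ _≼?_ z x)
    ... | yes (z , Pz , z≺x) = go (rs z≺x) Pz
    ... | no ∄z             = x , Px , λ Pz z≺x → ∄z (_ , Pz , z≺x)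

  ∪-minimal-isIdeal : ∀ {I y} → IsIdeal I → (∀ {z} → z ∉ₛ I → ¬ z ≺ y) → IsIdeal (I ∪ ⁅ y ⁆)
  ∪-minimal-isIdeal {I} {y} isIdeal y-minimal {i} {j} j∈ i≼j with i ∈? I | x∈p∪q⁻ I ⁅ y ⁆ j∈
  ... | yes i∈I | _        = x∈p∪q⁺ (inj₁ i∈I)
  ... | no i∉I  | inj₁ j∈I = contradiction (isIdeal j∈I i≼j) i∉I
  ... | no i∉I  | inj₂ j∈y = x∈p∪q⁺ (inj₂ (subst (_∈ₛ ⁅ y ⁆) (sym i≡y) (x∈⁅x⁆ y)))
    where
    i≼y : i ≼ y
    i≼y = subst (i ≼_) (x∈⁅y⁆⇒x≡y y j∈y) i≼j

    i≡y : i ≡ y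
    i≡y = decidable-stable (i Fin.≟ y) λ i≢y → y-minimal i∉I (i≼y , i≢y)

  ∃-ideal-of-size : ∀ k → k ≤ n → ∃ λ I → IsIdeal I × ∣ I ∣ ≡ k
  ∃-ideal-of-size zero    _   = ⊥ , (λ j∈⊥ _ → contradiction j∈⊥ ∉⊥) , ∣⊥∣≡0 n
  ∃-ideal-of-size (suc k) k<n =
    let I , isIdeal , ∣I∣≡k = ∃-ideal-of-size k (<⇒≤ k<n)
        x , x∉I = ∣p∣<n⇒∃∉ (subst (_< n) (sym ∣I∣≡k) k<n)
        y , y∉I , y-minimal = ∃-minimal (λ z → ¬? (z ∈? I)) x∉I
    in I ∪ ⁅ y ⁆ , ∪-minimal-isIdeal isIdeal y-minimal
                 , trans (x∉p⇒∣p∪⁅x⁆∣≡1+∣p∣ y∉I) (cong suc ∣I∣≡k)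

  ⊕⊆ideal⇒≡ : ∀ {r C I c c′} → ErrorCorrecting r C → IsIdeal I → ∣ I ∣ ≤ r →
              c ∈ C → c′ ∈ C → c ⊕ c′ ⊆ I → c ≡ c′
  ⊕⊆ideal⇒≡ {c = c} {c′} corrects isIdeal ∣I∣≤r c∈C c′∈C c⊕c′⊆I =
    cong proj₁ (corrects c c′ (c ⊕ c′) ⊥ c∈C c′∈C
      (≤-trans (wP≤∣I∣ isIdeal c⊕c′⊆I) ∣I∣≤r)
      (≤-trans (wP≤∣I∣ isIdeal λ x∈⊥ → contradiction x∈⊥ ∉⊥) ∣I∣≤r)
      (p⊕[p⊕q]≡q⊕⊥ c c′))

  length≤2^[n∸∣I∣] : ∀ {r C I} → ErrorCorrecting r C → Unique C → IsIdeal I → ∣ I ∣ ≤ r →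
                     length C ≤ 2 ^ (n ∸ ∣ I ∣)
  length≤2^[n∸∣I∣] {C = C} {I} corrects !C isIdeal ∣I∣≤r = ≮⇒≥ λ 2^[n∸∣I∣]<∣C∣ →
    let c , c′ , c∈C , c′∈C , c≢c′ , c─I≡c′─I =
          pigeonhole (≡-dec Bool._≟_) (_─ I) !C (λ {c} _ → ⊆⇒∈subsets (p─q⊆∁q c I))
                     (subst (_< length C) (sym ∣subsets[∁I]∣) 2^[n∸∣I∣]<∣C∣)
    in c≢c′ (⊕⊆ideal⇒≡ corrects isIdeal ∣I∣≤r c∈C c′∈C (p─r≡q─r⇒p⊕q⊆r c c′ I c─I≡c′─I))
    where
    ∣subsets[∁I]∣ : length (subsets (∁ I)) ≡ 2 ^ (n ∸ ∣ I ∣)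
    ∣subsets[∁I]∣ = trans (length-subsets (∁ I)) (cong (2 ^_) (∣∁p∣≡n∸∣p∣ I))

lemma1 : (n : ℕ) (_≼_ : Rel (Fin n) 0ℓ) → IsPartialOrder _≡_ _≼_ →
         (_≼?_ : Decidable _≼_) → (r m : ℕ) → r ≤ n → m ≤ n →
         (C : List (Subset n)) → Unique C → length C ≡ 2 ^ (n ∸ m) →
         (∀ c c′ b b′ → c ∈ C → c′ ∈ C →
           wP _≼_ _≼?_ b ≤ r → wP _≼_ _≼?_ b′ ≤ r →
           c ⊕ b ≡ c′ ⊕ b′ → (c , b) ≡ (c′ , b′)) →
         r ≤ m
lemma1 n _≼_ po _≼?_ r m r≤n _ C !C ∣C∣≡2^[n∸m] corrects = ≮⇒≥ m≮r
  where
  open PosetCodes po _≼?_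

  m≮r : ¬ m < r
  m≮r m<r with I , isIdeal , ∣I∣≡1+m ← ∃-ideal-of-size (suc m) (≤-trans m<r r≤n) =
    <⇒≱ 2^[n∸1+m]<2^[n∸m] 2^[n∸m]≤2^[n∸1+m]
    where
    2^[n∸m]≤2^[n∸1+m] : 2 ^ (n ∸ m) ≤ 2 ^ (n ∸ suc m)
    2^[n∸m]≤2^[n∸1+m] = subst₂ _≤_ ∣C∣≡2^[n∸m] (cong (λ k → 2 ^ (n ∸ k)) ∣I∣≡1+m)
      (length≤2^[n∸∣I∣] corrects !C isIdeal (subst (_≤ r) (sym ∣I∣≡1+m) m<r))

    2^[n∸1+m]<2^[n∸m] : 2 ^ (n ∸ suc m) < 2 ^ (n ∸ m)
    2^[n∸1+m]<2^[n∸m] = ^-monoʳ-< 2 (s≤s (s≤s z≤n)) (∸-monoʳ-< (n<1+n m) (≤-trans m<r r≤n))
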